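{- Let $\mathbb{T} = \{ T_n = \tfrac{n(n+1)}{2} : n \ge 1\}$ be the set of positive triangular numbers. If $f$ is a multiplicative function satisfying \[ f(a+b+c+d) = f(a)+f(b)+f(c)+f(d) \] for all $a,b,c,d \in \mathbb{T}$, then $f$ is the identity function, i.e. $f(n)=n$ for all positive integers $n$.
   Context: A multiplicative function is a complex-valued function $f$ on the positive integers, not identically zero, with $f(mn)=f(m)f(n)$ whenever $\gcd(m,n)=1$. -}

module Defs where

open import Level using (Level)
open import Data.Nat using (ℕ; zero; suc; _≥_; _/_)
import Data.Nat as ℕ
open import Data.Nat.Coprimality using (Coprime)
open import Data.Product using (∃) renaming (_×_ to _∧_)
open import Relation.Nullary using (¬_)
open import Algebra.Bundles using (CommutativeRing)
import Algebra.Bundles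

T : ℕ → ℕ
T n = (n ℕ.* suc n) / 2

module _ {c ℓ : Level} (R : CommutativeRing c ℓ) where
  open CommutativeRing R

  embed : ℕ → Carrier
  embed n = n × 1#
    where open import Algebra.Definitions.RawSemiring (Algebra.Bundles.Semiring.rawSemiring semiring) using (_×_)

  -- f is a function on the positive integers (values at 0 are ignored).
  -- Multiplicative: not identically zero on positive integers, and
  -- f(mn) = f(m) f(n) whenever m, n ≥ 1 and gcd(m,n) = 1.
  Multiplicative : (ℕ → Carrier) → Set ℓ
  Multiplicative f =
    (∃ λ n → n ≥ 1 ∧ ¬ (f n ≈ 0#)) ∧
    (∀ m n → m ≥ 1 → n ≥ 1 → Coprime m n → f (m ℕ.* n) ≈ f m * f n)

-- Stand-in for ℂ (not available in agda-stdlib): a field of characteristic zero,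
-- given as a commutative ring with 1 ≠ 0, inverses of nonzero elements,
-- and n·1 ≠ 0 for every n ≥ 1.
record IsCharZeroField {c ℓ : Level} (R : CommutativeRing c ℓ) : Set (c Level.⊔ ℓ) where
  open CommutativeRing R
  field
    inverse   : ∀ x → ¬ (x ≈ 0#) → ∃ λ y → x * y ≈ 1#
    charZero  : ∀ n → n ≥ 1 → ¬ (embed R n ≈ 0#)

-- Write  "f fixes n"  for  f n = n.  The proof has four steps.
--  1. Arithmetic of T: the recurrence T (n+1) = T n + (n+1), the factorisations
--     T (2m) = m (2m+1) and T (2m+1) = (2m+1)(m+1) into coprime factors, and
--     the identity T (n+2) + T n + 6 + 6 = T (n+1) + T (n+1) + 10 + 3.
--  2. General facts on multiplicative functions into a field of characteristic
--     zero: f 1 = 1, and if a, b are coprime and f fixes a and a b, then f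
--     fixes b (cancel the nonzero element a).
--  3. f fixes 3: with b = f 3, the values f 4, f 6, f 10, f 15, f 20, f 21,
--     f 28 are sums of four triangular numbers, and f 3 f 20 = f 4 f 15,
--     f 3 f 28 = f 4 f 21 give two quadratics in b whose combination is
--     36 b = 108.  Then f fixes every triangular number, by induction along
--     the identity of step 1.
--  4. If f fixes m, then T (2m) = m (2m+1) shows f fixes 2m+1, and then
--     T (2m+1) = (2m+1)(m+1) shows f fixes m+1; induction on m concludes.
module Submission where

open import Defs
open import Level using (Level)
open import Algebra.Bundles using (CommutativeRing)
open import Data.Nat as ℕ using (ℕ; zero; suc; _≥_)
import Data.Nat.Properties as ℕP
open import Data.Nat.Coprimality using (Coprime; coprime?; 1-coprimeTo)
import Data.Nat.Coprimality as Coprime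
open import Data.Product using (_,_; proj₁; proj₂)
open import Relation.Nullary using (¬_)
open import Relation.Nullary.Decidable using (from-yes)
import Relation.Binary.PropositionalEquality as ≡

module TriangularArithmetic where
  open import Data.Nat using (_+_; _*_)
  open import Data.Nat.DivMod using (m*n/n≡m)
  open import Data.Nat.Divisibility using (_∣_; ∣m+n∣m⇒∣n; ∣m∣n⇒∣m+n; ∣1⇒≡1)
  open import Data.Nat.Tactic.RingSolver using (solve-∀)
  open ≡ using (_≡_; cong; sym; trans; subst)
  open ≡.≡-Reasoning

  T-from-double : ∀ n k → n * suc n ≡ k * 2 → T n ≡ k
  T-from-double n k e = trans (cong (ℕ._/ 2) e) (m*n/n≡m k 2)

  T-double : ∀ n → n * suc n ≡ T n * 2
  T-suc    : ∀ n → T (suc n) ≡ T n + suc n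

  T-suc-double : ∀ n → suc n * suc (suc n) ≡ (T n + suc n) * 2
  T-suc-double n = begin
    suc n * suc (suc n)   ≡⟨ expand n ⟩
    n * suc n + suc n * 2 ≡⟨ cong (_+ suc n * 2) (T-double n) ⟩
    T n * 2 + suc n * 2   ≡⟨ sym (ℕP.*-distribʳ-+ 2 (T n) (suc n)) ⟩
    (T n + suc n) * 2     ∎
    where
    expand : ∀ n → suc n * suc (suc n) ≡ n * suc n + suc n * 2
    expand = solve-∀

  T-double zero    = ≡.refl
  T-double (suc n) = trans (T-suc-double n) (cong (_* 2) (sym (T-suc n)))

  T-suc n = T-from-double (suc n) _ (T-suc-double n)

  T-even : ∀ m → T (m + m) ≡ m * suc (m + m)
  T-even m = T-from-double (m + m) _ (double m)
    where
    double : ∀ m → (m + m) * suc (m + m) ≡ m * suc (m + m) * 2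
    double = solve-∀

  T-odd : ∀ m → T (suc (m + m)) ≡ suc (m + m) * suc m
  T-odd m = T-from-double (suc (m + m)) _ (double m)
    where
    double : ∀ m → suc (m + m) * suc (suc (m + m)) ≡ suc (m + m) * suc m * 2
    double = solve-∀

  -- Two sums of four triangular numbers (6 = T 3, 10 = T 4, 3 = T 2) that
  -- agree; it lets additivity pass from T n, T (n+1) to T (n+2).
  T-recurrence : ∀ n → T (suc (suc n)) + T n + 6 + 6 ≡ T (suc n) + T (suc n) + 10 + 3
  T-recurrence n rewrite T-suc (suc n) | T-suc n = rearrange (T n) n
    where
    rearrange : ∀ t n → t + suc n + suc (suc n) + t + 6 + 6
                      ≡ t + suc n + (t + suc n) + 10 + 3
    rearrange = solve-∀

  coprime-m-2m+1 : ∀ m → Coprime m (suc (m + m))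
  coprime-m-2m+1 m {d} (d∣m , d∣2m+1) =
    ∣1⇒≡1 (∣m+n∣m⇒∣n (subst (d ∣_) (ℕP.+-comm 1 (m + m)) d∣2m+1) (∣m∣n⇒∣m+n d∣m d∣m))

  coprime-2m+1-m+1 : ∀ m → Coprime (suc (m + m)) (suc m)
  coprime-2m+1-m+1 m {d} (d∣2m+1 , d∣m+1) =
    ∣1⇒≡1 (∣m+n∣m⇒∣n (subst (d ∣_) (twice m) (∣m∣n⇒∣m+n d∣m+1 d∣m+1)) d∣2m+1)
    where
    twice : ∀ m → suc m + suc m ≡ suc (m + m) + 1
    twice = solve-∀

open TriangularArithmetic

module MultiplicativeIntoField {c ℓ : Level} (R : CommutativeRing c ℓ) (F : IsCharZeroField R) where
  open CommutativeRing R hiding (zero)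
  open IsCharZeroField F
  open import Relation.Binary.Reasoning.Setoid setoid
  open import Algebra.Properties.Semiring.Mult semiring using (×-homo-+; ×1-homo-*)
  open import Algebra.Properties.Group +-group using () renaming (∙-cancelʳ to +-cancelʳ)
  open import Algebra.Solver.Ring.NaturalCoefficients.Default commutativeSemiring

  cancel-nonzero : ∀ {x a b} → ¬ (x ≈ 0#) → x * a ≈ x * b → a ≈ b
  cancel-nonzero {x} {a} {b} x≉0 xa≈xb with inverse x x≉0
  ... | y , xy≈1 = begin
    a           ≈⟨ solve 1 (λ a → a := con 1 :* a) refl a ⟩
    1# * a      ≈⟨ *-congʳ (sym xy≈1) ⟩
    (x * y) * a ≈⟨ solve 3 (λ x y a → (x :* y) :* a := y :* (x :* a)) refl x y a ⟩
    y * (x * a) ≈⟨ *-congˡ xa≈xb ⟩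
    y * (x * b) ≈⟨ solve 3 (λ x y b → y :* (x :* b) := (x :* y) :* b) refl x y b ⟩
    (x * y) * b ≈⟨ *-congʳ xy≈1 ⟩
    1# * b      ≈⟨ solve 1 (λ b → con 1 :* b := b) refl b ⟩
    b           ∎

  embed-+ : ∀ m n → embed R (m ℕ.+ n) ≈ embed R m + embed R n
  embed-+ m n = ×-homo-+ 1# m n

  embed-+₄ : ∀ m n p q → embed R (m ℕ.+ n ℕ.+ p ℕ.+ q) ≈ ((embed R m + embed R n) + embed R p) + embed R q
  embed-+₄ m n p q = trans (embed-+ (m ℕ.+ n ℕ.+ p) q) (+-congʳ (trans (embed-+ (m ℕ.+ n) p) (+-congʳ (embed-+ m n))))

  embed-* : ∀ m n → embed R (m ℕ.* n) ≈ embed R m * embed R n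
  embed-* = ×1-homo-*

  module _ (f : ℕ → Carrier) (M : Multiplicative R f) where

    Fixes : ℕ → Set ℓ
    Fixes n = f n ≈ embed R n

    f-coprime : ∀ {m n} → m ≥ 1 → n ≥ 1 → Coprime m n → f (m ℕ.* n) ≈ f m * f n
    f-coprime = proj₂ M _ _

    -- f 1 = 1: cancel f n from f n · 1 = f (n · 1) = f n · f 1 for an n with f n ≠ 0.
    f-one : f 1 ≈ 1#
    f-one with proj₁ M
    ... | n , n≥1 , fn≉0 = sym (cancel-nonzero fn≉0 (begin
      f n * 1#    ≈⟨ *-identityʳ (f n) ⟩
      f n         ≈⟨ reflexive (≡.cong f (≡.sym (ℕP.*-identityʳ n))) ⟩
      f (n ℕ.* 1) ≈⟨ f-coprime n≥1 ℕP.0<1+n (Coprime.sym (1-coprimeTo n)) ⟩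
      f n * f 1   ∎))

    -- 1 · 1# unfolds to 1# + 0#.
    fixes-one : Fixes 1
    fixes-one = trans f-one (sym (+-identityʳ 1#))

    fixes-cofactor : ∀ {a b} → a ≥ 1 → b ≥ 1 → Coprime a b → Fixes a → Fixes (a ℕ.* b) → Fixes b
    fixes-cofactor {a} {b} a≥1 b≥1 a⊥b fixes-a fixes-ab = cancel-nonzero (charZero a a≥1) (begin
      embed R a * f b        ≈⟨ *-congʳ (sym fixes-a) ⟩
      f a * f b              ≈⟨ sym (f-coprime a≥1 b≥1 a⊥b) ⟩
      f (a ℕ.* b)            ≈⟨ fixes-ab ⟩
      embed R (a ℕ.* b)      ≈⟨ embed-* a b ⟩
      embed R a * embed R b  ∎)

    exchange : ∀ {a b k} → a ≥ 1 → b ≥ 1 → k ≥ 1 → Coprime a k → Coprime b k →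
               f a * f (b ℕ.* k) ≈ f b * f (a ℕ.* k)
    exchange {a} {b} {k} a≥1 b≥1 k≥1 a⊥k b⊥k = begin
      f a * f (b ℕ.* k)   ≈⟨ *-congˡ (f-coprime b≥1 k≥1 b⊥k) ⟩
      f a * (f b * f k)   ≈⟨ solve 3 (λ x y z → x :* (y :* z) := y :* (x :* z)) refl (f a) (f b) (f k) ⟩
      f b * (f a * f k)   ≈⟨ *-congˡ (sym (f-coprime a≥1 k≥1 a⊥k)) ⟩
      f b * f (a ℕ.* k)   ∎

    module _ (H : ∀ a b c d → f (T (suc a) ℕ.+ T (suc b) ℕ.+ T (suc c) ℕ.+ T (suc d))
                            ≈ ((f (T (suc a)) + f (T (suc b))) + f (T (suc c))) + f (T (suc d))) where

      fixes-sum : ∀ a b c d → Fixes (T (suc a)) → Fixes (T (suc b)) → Fixes (T (suc c)) → Fixes (T (suc d)) →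
                  Fixes (T (suc a) ℕ.+ T (suc b) ℕ.+ T (suc c) ℕ.+ T (suc d))
      fixes-sum a b c d fa fb fc fd = begin
        f (T (suc a) ℕ.+ T (suc b) ℕ.+ T (suc c) ℕ.+ T (suc d)) ≈⟨ H a b c d ⟩
        ((f (T (suc a)) + f (T (suc b))) + f (T (suc c))) + f (T (suc d))
          ≈⟨ +-cong (+-cong (+-cong fa fb) fc) fd ⟩
        ((embed R (T (suc a)) + embed R (T (suc b))) + embed R (T (suc c))) + embed R (T (suc d))
          ≈⟨ sym (embed-+₄ (T (suc a)) (T (suc b)) (T (suc c)) (T (suc d))) ⟩
        embed R (T (suc a) ℕ.+ T (suc b) ℕ.+ T (suc c) ℕ.+ T (suc d)) ∎

      fixes-summand : ∀ a b c d → Fixes (T (suc a) ℕ.+ T (suc b) ℕ.+ T (suc c) ℕ.+ T (suc d)) →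
                      Fixes (T (suc b)) → Fixes (T (suc c)) → Fixes (T (suc d)) → Fixes (T (suc a))
      fixes-summand a b c d fsum fb fc fd =
        +-cancelʳ (embed R (T (suc b))) _ _ (+-cancelʳ (embed R (T (suc c))) _ _ (+-cancelʳ (embed R (T (suc d))) _ _ (begin
          ((f (T (suc a)) + embed R (T (suc b))) + embed R (T (suc c))) + embed R (T (suc d))
            ≈⟨ +-cong (+-cong (+-congˡ (sym fb)) (sym fc)) (sym fd) ⟩
          ((f (T (suc a)) + f (T (suc b))) + f (T (suc c))) + f (T (suc d))
            ≈⟨ sym (H a b c d) ⟩
          f (T (suc a) ℕ.+ T (suc b) ℕ.+ T (suc c) ℕ.+ T (suc d)) ≈⟨ fsum ⟩
          embed R (T (suc a) ℕ.+ T (suc b) ℕ.+ T (suc c) ℕ.+ T (suc d))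
            ≈⟨ embed-+₄ (T (suc a)) (T (suc b)) (T (suc c)) (T (suc d)) ⟩
          ((embed R (T (suc a)) + embed R (T (suc b))) + embed R (T (suc c))) + embed R (T (suc d)) ∎)))

      module FixesThree where
        open import Algebra.Properties.Semiring.Mult.TCOptimised semiring using (×ᵤ≈×) renaming (_×_ to _×ₒ_)

        -- Numerals as the solver interprets its constants.
        #_ : ℕ → Carrier
        # k = k ×ₒ 1#

        embed≈# : ∀ k → embed R k ≈ # k
        embed≈# k = ×ᵤ≈× k 1#

        b : Carrier
        b = f 3

        f-4 : f 4 ≈ # 4
        f-4 = trans (H 0 0 0 0) (trans (+-cong (+-cong (+-cong f-one f-one) f-one) f-one)
                (solve 0 (((con 1 :+ con 1) :+ con 1) :+ con 1 := con 4) refl))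

        f-6 : f 6 ≈ # 3 + b
        f-6 = trans (H 0 0 0 1) (trans (+-cong (+-cong (+-cong f-one f-one) f-one) refl)
                (solve 1 (λ b → ((con 1 :+ con 1) :+ con 1) :+ b := con 3 :+ b) refl b))

        f-10 : f 10 ≈ # 1 + # 3 * b
        f-10 = trans (H 0 1 1 1) (trans (+-congʳ (+-congʳ (+-congʳ f-one)))
                 (solve 1 (λ b → ((con 1 :+ b) :+ b) :+ b := con 1 :+ con 3 :* b) refl b))

        f-15 : f 15 ≈ # 3 + # 4 * b
        f-15 = trans (H 1 1 1 2) (trans (+-congˡ f-6)
                 (solve 1 (λ b → ((b :+ b) :+ b) :+ (con 3 :+ b) := con 3 :+ con 4 :* b) refl b))

        f-20 : f 20 ≈ # 5 + # 5 * b
        f-20 = trans (H 0 1 2 3) (trans (+-cong (+-cong (+-congʳ f-one) f-6) f-10)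
                 (solve 1 (λ b → ((con 1 :+ b) :+ (con 3 :+ b)) :+ (con 1 :+ con 3 :* b)
                                 := con 5 :+ con 5 :* b) refl b))

        f-21 : f 21 ≈ # 9 + # 4 * b
        f-21 = trans (H 1 2 2 2) (trans (+-cong (+-cong (+-congˡ f-6) f-6) f-6)
                 (solve 1 (λ b → ((b :+ (con 3 :+ b)) :+ (con 3 :+ b)) :+ (con 3 :+ b)
                                 := con 9 :+ con 4 :* b) refl b))

        f-28 : f 28 ≈ # 10 + # 6 * b
        f-28 = trans (H 2 2 2 3) (trans (+-cong (+-cong (+-cong f-6 f-6) f-6) f-10)
                 (solve 1 (λ b → (((con 3 :+ b) :+ (con 3 :+ b)) :+ (con 3 :+ b)) :+ (con 1 :+ con 3 :* b)
                                 := con 10 :+ con 6 :* b) refl b))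

        quadratic₁ : b * (# 5 + # 5 * b) ≈ # 4 * (# 3 + # 4 * b)
        quadratic₁ = begin
          b * (# 5 + # 5 * b)  ≈⟨ *-congˡ (sym f-20) ⟩
          f 3 * f 20           ≈⟨ exchange ℕP.0<1+n ℕP.0<1+n ℕP.0<1+n (from-yes (coprime? 3 5)) (from-yes (coprime? 4 5)) ⟩
          f 4 * f 15           ≈⟨ *-cong f-4 f-15 ⟩
          # 4 * (# 3 + # 4 * b) ∎

        quadratic₂ : b * (# 10 + # 6 * b) ≈ # 4 * (# 9 + # 4 * b)
        quadratic₂ = begin
          b * (# 10 + # 6 * b) ≈⟨ *-congˡ (sym f-28) ⟩
          f 3 * f 28           ≈⟨ exchange ℕP.0<1+n ℕP.0<1+n ℕP.0<1+n (from-yes (coprime? 3 7)) (from-yes (coprime? 4 7)) ⟩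
          f 4 * f 21           ≈⟨ *-cong f-4 f-21 ⟩
          # 4 * (# 9 + # 4 * b) ∎

        -- 6 · quadratic₁ − 5 · quadratic₂ is linear: 36 b = 108.  The common
        -- quadratic part K is cancelled instead of subtracted.
        linear : # 36 * b ≈ # 108
        linear = sym (+-cancelʳ K _ _ (begin
          # 108 + K
            ≈⟨ solve 1 (λ b → con 108 :+ (con 30 :* b :* b :+ con 110 :* b :+ con 72)
                              := con 6 :* (b :* (con 5 :+ con 5 :* b)) :+ con 5 :* (con 4 :* (con 9 :+ con 4 :* b))) refl b ⟩
          # 6 * (b * (# 5 + # 5 * b)) + # 5 * (# 4 * (# 9 + # 4 * b))
            ≈⟨ +-cong (*-congˡ quadratic₁) (*-congˡ (sym quadratic₂)) ⟩
          # 6 * (# 4 * (# 3 + # 4 * b)) + # 5 * (b * (# 10 + # 6 * b))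
            ≈⟨ solve 1 (λ b → con 6 :* (con 4 :* (con 3 :+ con 4 :* b)) :+ con 5 :* (b :* (con 10 :+ con 6 :* b))
                              := con 36 :* b :+ (con 30 :* b :* b :+ con 110 :* b :+ con 72)) refl b ⟩
          # 36 * b + K ∎))
          where
          K : Carrier
          K = # 30 * b * b + # 110 * b + # 72

        fixes-three : Fixes 3
        fixes-three = cancel-nonzero (charZero 36 ℕP.0<1+n) (begin
          embed R 36 * f 3       ≈⟨ *-congʳ (embed≈# 36) ⟩
          # 36 * b               ≈⟨ linear ⟩
          # 108                  ≈⟨ solve 0 (con 108 := con 36 :* con 3) refl ⟩
          # 36 * # 3             ≈⟨ sym (*-cong (embed≈# 36) (embed≈# 3)) ⟩
          embed R 36 * embed R 3 ∎)

      open FixesThree using (fixes-three)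

      fixes-six : Fixes 6
      fixes-six = fixes-sum 0 0 0 1 fixes-one fixes-one fixes-one fixes-three

      fixes-ten : Fixes 10
      fixes-ten = fixes-sum 0 1 1 1 fixes-one fixes-three fixes-three fixes-three

      fixes-triangular : ∀ n → Fixes (T (suc n))
      fixes-triangular zero          = fixes-one
      fixes-triangular (suc zero)    = fixes-three
      fixes-triangular (suc (suc n)) =
        fixes-summand (suc (suc n)) n 2 2
          (≡.subst Fixes (≡.sym (T-recurrence (suc n)))
            (fixes-sum (suc n) (suc n) 3 1 (fixes-triangular (suc n)) (fixes-triangular (suc n)) fixes-ten fixes-three))
          (fixes-triangular n) fixes-six fixes-six

      -- f fixes m ⇒ f fixes 2m+1 (via T (2m) = m (2m+1)) ⇒ f fixes m+1
      -- (via T (2m+1) = (2m+1)(m+1)).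
      fixes-successor : ∀ p → Fixes (suc p) → Fixes (suc (suc p))
      fixes-successor p fixes-m =
        fixes-cofactor ℕP.0<1+n ℕP.0<1+n (coprime-2m+1-m+1 m) fixes-2m+1
          (≡.subst Fixes (T-odd m) (fixes-triangular (m ℕ.+ m)))
        where
        m : ℕ
        m = suc p
        fixes-2m+1 : Fixes (suc (m ℕ.+ m))
        fixes-2m+1 = fixes-cofactor ℕP.0<1+n ℕP.0<1+n (coprime-m-2m+1 m) fixes-m
          (≡.subst Fixes (T-even m) (fixes-triangular (p ℕ.+ m)))

      fixes-positive : ∀ n → Fixes (suc n)
      fixes-positive zero    = fixes-one
      fixes-positive (suc n) = fixes-successor n (fixes-positive n)

open import Data.Nat using (_+_)

theorem3p1 : {c ℓ : Level} (R : CommutativeRing c ℓ) → IsCharZeroField R →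
    (f : ℕ → CommutativeRing.Carrier R) → Multiplicative R f →
    (∀ a b c d → CommutativeRing._≈_ R
        (f (T (suc a) + T (suc b) + T (suc c) + T (suc d)))
        (CommutativeRing._+_ R (CommutativeRing._+_ R (CommutativeRing._+_ R
          (f (T (suc a))) (f (T (suc b)))) (f (T (suc c)))) (f (T (suc d))))) →
    ∀ n → n ≥ 1 → CommutativeRing._≈_ R (f n) (embed R n)
theorem3p1 R F f M H (suc n) _ = MultiplicativeIntoField.fixes-positive R F f M H n
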